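{- Let $L_{n,k}(q)$ ($1\le k\le n$) be as defined below. Then $L_{1,1}(q)=g$, and for $n\ge1$: $L_{n+1,1}(q)=g\,D_qL_{n,1}(q)$; $L_{n+1,n+1}(q)=g\,L_{n,n}(q)$; and $L_{n+1,k}(q)=g\,D_qL_{n,k}(q)+g\,q^{n-k+1}L_{n,k-1}(q)$ for $1<k\le n$.
   Context: Let $g$ be a formal power series in $x$ (coefficients in a field containing the indeterminate $q$). $D_qh(x)=\frac{h(x)-h(xq)}{x-xq}$. For $i,j\ge0$, $g_i^{(j)}(x)=(D_q^ig)(q^jx)$. $[m]_q=1+q+\dots+q^{m-1}$, $[m]_q!=[1]_q\cdots[m]_q$, $[0]_q!=1$. For $1\le k\le n$, $L_{n,k}(q)=\frac{g_0^{(0)}}{[k]_q!}\sum[2-K_1]_q\cdots[n-K_{n-1}]_q\frac{g_{k_1}^{(0)}}{[k_1]_q!}\frac{g_{k_2}^{(K_1)}}{[k_2]_q!}\cdots\frac{g_{k_{n-1}}^{(K_{n-2})}}{[k_{n-1}]_q!}$, summed over nonnegative integer sequences $(k_1,\dots,k_{n-1})$ with $k_1+\dots+k_{n-1}=n-k$ and $K_j=k_1+\dots+k_j\le j$ for all $j$; these are the coefficients for which $(gD_q)^nf=\sum_{k=1}^nL_{n,k}(q)(D_q^kf)(q^{n-k}x)$ for every power series $f$, where $(gD_q)$ is $h\mapsto gD_qh$. -}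

module Defs where

open import Level using (Level)
open import Algebra.Bundles using (CommutativeRing)
open import Data.Nat using (ℕ; zero; suc; _∸_; _≤ᵇ_; _≡ᵇ_)
  renaming (_*_ to _*ℕ_; _+_ to _+ℕ_)
open import Data.Nat.ListAction using (sum)
open import Data.Bool using (Bool; true; false; _∧_)
open import Data.List using (List; []; _∷_; map; concatMap; filterᵇ; foldr; upTo)

tuples : ℕ → ℕ → List (List ℕ)
tuples zero    b = [] ∷ []
tuples (suc m) b = concatMap (λ x → map (x ∷_) (tuples m b)) (upTo (suc b))

-- prefixOK j K ks : with K = k_1+…+k_{j-1} already accumulated and
-- ks = (k_j, k_{j+1}, …), checks K_i = k_1+…+k_i ≤ i for all i ≥ j.
prefixOK : ℕ → ℕ → List ℕ → Bool
prefixOK j K []       = true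
prefixOK j K (k ∷ ks) = ((K +ℕ k) ≤ᵇ j) ∧ prefixOK (suc j) (K +ℕ k) ks

admissible : ℕ → ℕ → List ℕ → Bool
admissible n k ks = (sum ks ≡ᵇ (n ∸ k)) ∧ prefixOK 1 0 ks

-- Formal power series over a commutative ring R (intended: a field),
-- represented by coefficient sequences; q ∈ R, and _⁻¹ the field inverse.
module Series {c ℓ : Level} (R : CommutativeRing c ℓ)
               (_⁻¹ : CommutativeRing.Carrier R → CommutativeRing.Carrier R)
               (q : CommutativeRing.Carrier R) where
  open CommutativeRing R

  FPS : Set c
  FPS = ℕ → Carrier

  _≋_ : FPS → FPS → Set ℓ
  f ≋ h = ∀ m → f m ≈ h m

  pow : Carrier → ℕ → Carrier
  pow a zero    = 1#
  pow a (suc n) = a * pow a n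

  Σ< : ℕ → (ℕ → Carrier) → Carrier
  Σ< zero    f = 0#
  Σ< (suc m) f = Σ< m f + f m

  qint : ℕ → Carrier
  qint m = Σ< m (pow q)

  invqfact : ℕ → Carrier
  invqfact zero    = 1#
  invqfact (suc m) = invqfact m * (qint (suc m) ⁻¹)

  zeroS : FPS
  zeroS m = 0#

  oneS : FPS
  oneS zero    = 1#
  oneS (suc m) = 0#

  _⊕_ : FPS → FPS → FPS
  (f ⊕ h) m = f m + h m

  _⊛_ : FPS → FPS → FPS
  (f ⊛ h) m = Σ< (suc m) (λ i → f i * h (m ∸ i))

  scale : Carrier → FPS → FPS
  scale a f m = a * f m

  -- D_q h(x) = (h(x) - h(qx)) / (x - qx): coefficient m is [m+1]_q h_{m+1}
  Dq : FPS → FPS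
  Dq h m = qint (suc m) * h (suc m)

  Dq^ : ℕ → FPS → FPS
  Dq^ zero    h = h
  Dq^ (suc i) h = Dq (Dq^ i h)

  -- h(q^j x)
  dil : ℕ → FPS → FPS
  dil j h m = pow q (j *ℕ m) * h m

  module _ (g : FPS) where
    gij : ℕ → ℕ → FPS
    gij i j = dil j (Dq^ i g)

    -- term j K (k_j, …, k_{n-1}) with K = K_{j-1}:
    -- ∏_{i ≥ j} [i+1-K_i]_q · g_{k_i}^{(K_{i-1})} / [k_i]_q!
    term : ℕ → ℕ → List ℕ → FPS
    term j K []       = oneS
    term j K (k ∷ ks) =
      scale (qint (suc j ∸ (K +ℕ k)) * invqfact k) (gij k K)
        ⊛ term (suc j) (K +ℕ k) ks

    sumS : List FPS → FPS
    sumS = foldr _⊕_ zeroS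

    L : ℕ → ℕ → FPS
    L n k = scale (invqfact k) (gij 0 0)
              ⊛ sumS (map (term 1 0) (filterᵇ (admissible n k) (tuples (n ∸ 1) n)))

-- Write L_{n,k} = g/[k]_q! · T(n−1, n−k), where T(m, r) is the sum of the products
-- Π_j [j+1−K_j]_q g_{k_j}^{(K_{j−1})}/[k_j]_q! over all (k_1, …, k_m) with sum r: the constraint
-- K_j ≤ j may be dropped, since whenever K_j > j the factor [j+1−K_j]_q is [0]_q = 0, the
-- subtraction being truncated. Splitting off the last entry gives
--   T(m+1, r) = [m+2−r]_q Σ_{x≤r} T(m, r−x) g_x^{(r−x)}/[x]_q!,
-- and with the q-Leibniz rule D_q(fh) = (D_q f)·h(qx) + f·D_q h and D_q(g_x^{(a)}) = q^a g_{x+1}^{(a)}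
-- one proves by induction on n that
--   T(n+1, K) = D_q(g T(n, K−1)) + q^K [n+2−K]_q g T(n, K).
-- Multiplying the case K = n+2−k by g/[k]_q! gives the recurrences for L_{n+2,k}.

module Submission where

open import Defs
open import Level using (Level)
open import Algebra.Bundles using (CommutativeRing; CommutativeSemiring)
open import Algebra.Structures.Biased using (IsCommutativeSemiringˡ)
import Algebra.Properties.CommutativeSemigroup as CommSemigroupProperties
open import Data.Bool using (Bool; true; false; if_then_else_; T)
open import Data.Nat using (ℕ; zero; suc; _∸_; _≤_; _<_; _≤?_; s≤s; _≡ᵇ_; _≤ᵇ_)
  renaming (_+_ to _+ℕ_; _*_ to _*ℕ_)
import Data.Nat.Properties as ℕ
open import Data.Nat.ListAction using (sum)
open import Data.Nat.ListAction.Properties using (sum-++)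
open import Data.List using (List; []; _∷_; _++_; [_]; map; concatMap; filterᵇ; upTo; applyUpTo; length)
open import Data.List.Properties using (map-++; map-∘)
open import Data.Product using (_×_; _,_)
open import Data.Sum using (inj₁; inj₂)
open import Relation.Binary.PropositionalEquality as ≡ using (_≡_)
open import Relation.Binary.Structures using (IsEquivalence)
import Relation.Binary.Reasoning.Setoid as SetoidReasoning
open import Relation.Nullary using (¬_; yes; no)
open import Relation.Nullary.Decidable using (dec-false)

≡ᵇ-+-cancelˡ : ∀ x s t → (x +ℕ s ≡ᵇ x +ℕ t) ≡ (s ≡ᵇ t)
≡ᵇ-+-cancelˡ zero    s t = ≡.refl
≡ᵇ-+-cancelˡ (suc x) s t = ≡ᵇ-+-cancelˡ x s t

≡ᵇ-+-∸ : ∀ {s x r} → x ≤ r → (s +ℕ x ≡ᵇ r) ≡ (s ≡ᵇ r ∸ x)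
≡ᵇ-+-∸ {s} {x} {r} x≤r = begin
  (s +ℕ x ≡ᵇ r)               ≡⟨ ≡.cong₂ _≡ᵇ_ (ℕ.+-comm s x) (≡.sym (ℕ.m+[n∸m]≡n x≤r)) ⟩
  (x +ℕ s ≡ᵇ x +ℕ (r ∸ x))    ≡⟨ ≡ᵇ-+-cancelˡ x s (r ∸ x) ⟩
  (s ≡ᵇ r ∸ x)                ∎
  where open ≡.≡-Reasoning

module SeriesProperties {c ℓ : Level} (R : CommutativeRing c ℓ)
  (_⁻¹ : CommutativeRing.Carrier R → CommutativeRing.Carrier R)
  (q : CommutativeRing.Carrier R) where

  open CommutativeRing R
  open Series R _⁻¹ q
  open CommSemigroupProperties *-commutativeSemigroup using (x∙yz≈y∙xz; xy∙z≈y∙xz)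
  open CommSemigroupProperties +-commutativeSemigroup using ()
    renaming (x∙yz≈y∙xz to x+yz≈y+xz; interchange to +-interchange)

  module Coefficientwise where
    open SetoidReasoning setoid

    Σ<-cong : ∀ n {f h : ℕ → Carrier} → (∀ i → i < n → f i ≈ h i) → Σ< n f ≈ Σ< n h
    Σ<-cong zero    f≈h = refl
    Σ<-cong (suc n) f≈h = +-cong (Σ<-cong n (λ i i<n → f≈h i (ℕ.m<n⇒m<1+n i<n))) (f≈h n ℕ.≤-refl)

    Σ<-zero : ∀ n → Σ< n (λ _ → 0#) ≈ 0#
    Σ<-zero zero    = refl
    Σ<-zero (suc n) = trans (+-identityʳ _) (Σ<-zero n)

    Σ<-distrib-+ : ∀ n (f h : ℕ → Carrier) → Σ< n (λ i → f i + h i) ≈ Σ< n f + Σ< n h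
    Σ<-distrib-+ zero    f h = sym (+-identityˡ 0#)
    Σ<-distrib-+ (suc n) f h = trans (+-cong (Σ<-distrib-+ n f h) refl) (+-interchange _ _ _ _)

    *-distribˡ-Σ< : ∀ n a (f : ℕ → Carrier) → a * Σ< n f ≈ Σ< n (λ i → a * f i)
    *-distribˡ-Σ< zero    a f = zeroʳ a
    *-distribˡ-Σ< (suc n) a f = trans (distribˡ a _ _) (+-cong (*-distribˡ-Σ< n a f) refl)

    *-distribʳ-Σ< : ∀ n a (f : ℕ → Carrier) → Σ< n f * a ≈ Σ< n (λ i → f i * a)
    *-distribʳ-Σ< zero    a f = zeroˡ a
    *-distribʳ-Σ< (suc n) a f = trans (distribʳ a _ _) (+-cong (*-distribʳ-Σ< n a f) refl)

    Σ<-head : ∀ n (f : ℕ → Carrier) → Σ< (suc n) f ≈ f 0 + Σ< n (λ i → f (suc i))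
    Σ<-head zero    f = trans (+-identityˡ _) (sym (+-identityʳ _))
    Σ<-head (suc n) f = trans (+-cong (Σ<-head n f) refl) (+-assoc _ _ _)

    Σ<-reverse : ∀ n (f : ℕ → Carrier) → Σ< n f ≈ Σ< n (λ i → f (n ∸ suc i))
    Σ<-reverse zero    f = refl
    Σ<-reverse (suc n) f = begin
      Σ< n f + f n                        ≈⟨ +-cong (Σ<-reverse n f) refl ⟩
      Σ< n (λ i → f (n ∸ suc i)) + f n    ≈⟨ +-comm _ _ ⟩
      f n + Σ< n (λ i → f (n ∸ suc i))    ≈⟨ Σ<-head n (λ i → f (n ∸ i)) ⟨
      Σ< (suc n) (λ i → f (n ∸ i))        ∎

    Σ<-swap : ∀ n k (a : ℕ → ℕ → Carrier) →
              Σ< n (λ i → Σ< k (a i)) ≈ Σ< k (λ j → Σ< n (λ i → a i j))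
    Σ<-swap zero    k a = sym (Σ<-zero k)
    Σ<-swap (suc n) k a =
      trans (+-cong (Σ<-swap n k a) refl) (sym (Σ<-distrib-+ k (λ j → Σ< n (λ i → a i j)) (a n)))

    Σ<-triangle : ∀ n (a : ℕ → ℕ → Carrier) →
      Σ< n (λ i → Σ< (n ∸ i) (a i)) ≈ Σ< n (λ s → Σ< (suc s) (λ i → a i (s ∸ i)))
    Σ<-triangle zero    a = refl
    Σ<-triangle (suc n) a = begin
      Σ< (suc n) (λ i → Σ< (suc n ∸ i) (a i))
        ≈⟨ Σ<-cong (suc n) (λ i i≤n → reflexive (≡.cong (λ k → Σ< k (a i)) (ℕ.+-∸-assoc 1 (ℕ.≤-pred i≤n)))) ⟩
      Σ< (suc n) (λ i → Σ< (n ∸ i) (a i) + a i (n ∸ i))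
        ≈⟨ Σ<-distrib-+ (suc n) _ _ ⟩
      (Σ< n (λ i → Σ< (n ∸ i) (a i)) + Σ< (n ∸ n) (a n)) + Σ< (suc n) (λ i → a i (n ∸ i))
        ≈⟨ +-cong (+-cong (Σ<-triangle n a) (reflexive (≡.cong (λ k → Σ< k (a n)) (ℕ.n∸n≡0 n)))) refl ⟩
      (Σ< n (λ s → Σ< (suc s) (λ i → a i (s ∸ i))) + 0#) + Σ< (suc n) (λ i → a i (n ∸ i))
        ≈⟨ +-cong (+-identityʳ _) refl ⟩
      Σ< n (λ s → Σ< (suc s) (λ i → a i (s ∸ i))) + Σ< (suc n) (λ i → a i (n ∸ i)) ∎

    Σ<-vanishing-tail : ∀ {m} n (f : ℕ → Carrier) → m ≤ n → (∀ i → m ≤ i → f i ≈ 0#) → Σ< n f ≈ Σ< m f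
    Σ<-vanishing-tail {m} n f m≤n f≈0 with ℕ.m≤n⇒m<n∨m≡n m≤n
    ... | inj₂ ≡.refl = refl
    Σ<-vanishing-tail {m} (suc n) f m≤n f≈0 | inj₁ (s≤s m≤n′) = begin
      Σ< n f + f n  ≈⟨ +-cong (Σ<-vanishing-tail n f m≤n′ f≈0) (f≈0 n m≤n′) ⟩
      Σ< m f + 0#   ≈⟨ +-identityʳ _ ⟩
      Σ< m f        ∎

    pow-+ : ∀ a m n → pow a (m +ℕ n) ≈ pow a m * pow a n
    pow-+ a zero    n = sym (*-identityˡ _)
    pow-+ a (suc m) n = trans (*-cong refl (pow-+ a m n)) (sym (*-assoc _ _ _))

    qint-+ : ∀ a b → qint (a +ℕ b) ≈ qint a + pow q a * qint b
    qint-+ a zero = begin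
      qint (a +ℕ 0)         ≈⟨ reflexive (≡.cong qint (ℕ.+-identityʳ a)) ⟩
      qint a                ≈⟨ +-identityʳ _ ⟨
      qint a + 0#           ≈⟨ +-cong refl (zeroʳ _) ⟨
      qint a + pow q a * 0# ∎
    qint-+ a (suc b) = begin
      qint (a +ℕ suc b)                                ≈⟨ reflexive (≡.cong qint (ℕ.+-suc a b)) ⟩
      qint (a +ℕ b) + pow q (a +ℕ b)                   ≈⟨ +-cong (qint-+ a b) (pow-+ q a b) ⟩
      (qint a + pow q a * qint b) + pow q a * pow q b  ≈⟨ +-assoc _ _ _ ⟩
      qint a + (pow q a * qint b + pow q a * pow q b)  ≈⟨ +-cong refl (distribˡ _ _ _) ⟨
      qint a + pow q a * (qint b + pow q b)            ∎

    pow-*-qint-+ : ∀ b s t → pow q b * qint (s +ℕ t) ≈ pow q b * qint s + pow q (b +ℕ s) * qint t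
    pow-*-qint-+ b s t = begin
      pow q b * qint (s +ℕ t)                              ≈⟨ *-cong refl (qint-+ s t) ⟩
      pow q b * (qint s + pow q s * qint t)                ≈⟨ distribˡ _ _ _ ⟩
      pow q b * qint s + pow q b * (pow q s * qint t)      ≈⟨ +-cong refl (*-assoc _ _ _) ⟨
      pow q b * qint s + pow q b * pow q s * qint t        ≈⟨ +-cong refl (*-cong (pow-+ q b s) refl) ⟨
      pow q b * qint s + pow q (b +ℕ s) * qint t           ∎

    pow-*-qint-∸ : ∀ {N K x} → x ≤ K → suc K ≤ N →
      pow q (K ∸ x) * qint (N ∸ (K ∸ x)) ≈ pow q (K ∸ x) * qint (suc x) + pow q (suc K) * qint (N ∸ suc K)
    pow-*-qint-∸ {N} {K} {x} x≤K 1+K≤N = begin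
      pow q a * qint (N ∸ a)                                ≡⟨ ≡.cong (λ t → pow q a * qint t) N∸a≡ ⟩
      pow q a * qint (suc x +ℕ (N ∸ suc K))                 ≈⟨ pow-*-qint-+ a (suc x) (N ∸ suc K) ⟩
      pow q a * qint (suc x) + pow q (a +ℕ suc x) * qint (N ∸ suc K)
        ≡⟨ ≡.cong (λ e → pow q a * qint (suc x) + pow q e * qint (N ∸ suc K)) a+1+x≡ ⟩
      pow q a * qint (suc x) + pow q (suc K) * qint (N ∸ suc K) ∎
      where
      a = K ∸ x
      a+1+x≡ : a +ℕ suc x ≡ suc K
      a+1+x≡ = ≡.trans (ℕ.+-suc a x) (≡.cong suc (ℕ.m∸n+n≡m x≤K))
      N∸a≡ : N ∸ a ≡ suc x +ℕ (N ∸ suc K)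
      N∸a≡ = ≡.trans (≡.cong (_∸ a) (≡.sym (≡.trans (≡.sym (ℕ.+-assoc a (suc x) (N ∸ suc K)))
                                          (≡.trans (≡.cong (_+ℕ (N ∸ suc K)) a+1+x≡) (ℕ.m+[n∸m]≡n 1+K≤N)))))
                     (ℕ.m+n∸m≡n a (suc x +ℕ (N ∸ suc K)))

    ⊕-cong : ∀ {f f′ h h′} → f ≋ f′ → h ≋ h′ → (f ⊕ h) ≋ (f′ ⊕ h′)
    ⊕-cong f≋f′ h≋h′ m = +-cong (f≋f′ m) (h≋h′ m)

    ⊛-cong : ∀ {f f′ h h′} → f ≋ f′ → h ≋ h′ → (f ⊛ h) ≋ (f′ ⊛ h′)
    ⊛-cong f≋f′ h≋h′ m = Σ<-cong (suc m) (λ i _ → *-cong (f≋f′ i) (h≋h′ (m ∸ i)))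

    ⊛-congˡ : ∀ f {h h′} → h ≋ h′ → (f ⊛ h) ≋ (f ⊛ h′)
    ⊛-congˡ f = ⊛-cong {f = f} (λ m → refl)

    ⊛-congʳ : ∀ h {f f′} → f ≋ f′ → (f ⊛ h) ≋ (f′ ⊛ h)
    ⊛-congʳ h f≋f′ = ⊛-cong {h = h} f≋f′ (λ m → refl)

    ⊛-comm : ∀ f h → (f ⊛ h) ≋ (h ⊛ f)
    ⊛-comm f h m = begin
      Σ< (suc m) (λ i → f i * h (m ∸ i))            ≈⟨ Σ<-reverse (suc m) _ ⟩
      Σ< (suc m) (λ i → f (m ∸ i) * h (m ∸ (m ∸ i))) ≈⟨ Σ<-cong (suc m) reindex ⟩
      Σ< (suc m) (λ i → h i * f (m ∸ i))            ∎
      where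
      reindex : ∀ i → i < suc m → f (m ∸ i) * h (m ∸ (m ∸ i)) ≈ h i * f (m ∸ i)
      reindex i i≤m = trans (*-comm _ _) (*-cong (reflexive (≡.cong h (ℕ.m∸[m∸n]≡n (ℕ.≤-pred i≤m)))) refl)

    ⊛-assoc : ∀ f g h → ((f ⊛ g) ⊛ h) ≋ (f ⊛ (g ⊛ h))
    ⊛-assoc f g h m = begin
      Σ< (suc m) (λ s → Σ< (suc s) (λ i → f i * g (s ∸ i)) * h (m ∸ s))
        ≈⟨ Σ<-cong (suc m) (λ s _ → *-distribʳ-Σ< (suc s) _ _) ⟩
      Σ< (suc m) (λ s → Σ< (suc s) (λ i → f i * g (s ∸ i) * h (m ∸ s)))
        ≈⟨ Σ<-cong (suc m) (λ s _ → Σ<-cong (suc s) (λ i i≤s →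
             trans (*-assoc _ _ _) (*-cong refl (*-cong refl (reflexive (≡.cong h (≡.sym (m∸i∸[s∸i] (ℕ.≤-pred i≤s))))))))) ⟩
      Σ< (suc m) (λ s → Σ< (suc s) (λ i → f i * (g (s ∸ i) * h (m ∸ i ∸ (s ∸ i)))))
        ≈⟨ Σ<-triangle (suc m) (λ i j → f i * (g j * h (m ∸ i ∸ j))) ⟨
      Σ< (suc m) (λ i → Σ< (suc m ∸ i) (λ j → f i * (g j * h (m ∸ i ∸ j))))
        ≈⟨ Σ<-cong (suc m) (λ i i≤m →
             trans (reflexive (≡.cong (λ k → Σ< k (λ j → f i * (g j * h (m ∸ i ∸ j)))) (ℕ.+-∸-assoc 1 (ℕ.≤-pred i≤m))))
                   (sym (*-distribˡ-Σ< (suc (m ∸ i)) _ _))) ⟩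
      Σ< (suc m) (λ i → f i * Σ< (suc (m ∸ i)) (λ j → g j * h (m ∸ i ∸ j))) ∎
      where
      m∸i∸[s∸i] : ∀ {i s} → i ≤ s → m ∸ i ∸ (s ∸ i) ≡ m ∸ s
      m∸i∸[s∸i] {i} {s} i≤s = ≡.trans (ℕ.∸-+-assoc m i (s ∸ i)) (≡.cong (m ∸_) (ℕ.m+[n∸m]≡n i≤s))

    ⊛-identityˡ : ∀ f → (oneS ⊛ f) ≋ f
    ⊛-identityˡ f m = begin
      Σ< (suc m) (λ i → oneS i * f (m ∸ i))             ≈⟨ Σ<-head m _ ⟩
      1# * f m + Σ< m (λ i → 0# * f (m ∸ suc i))        ≈⟨ +-cong (*-identityˡ _) (Σ<-cong m (λ i _ → zeroˡ _)) ⟩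
      f m + Σ< m (λ _ → 0#)                              ≈⟨ +-cong refl (Σ<-zero m) ⟩
      f m + 0#                                           ≈⟨ +-identityʳ _ ⟩
      f m                                                ∎

    ⊛-zeroˡ : ∀ f → (zeroS ⊛ f) ≋ zeroS
    ⊛-zeroˡ f m = trans (Σ<-cong (suc m) (λ i _ → zeroˡ _)) (Σ<-zero (suc m))

    ⊛-distribʳ : ∀ f g h → ((g ⊕ h) ⊛ f) ≋ ((g ⊛ f) ⊕ (h ⊛ f))
    ⊛-distribʳ f g h m = trans (Σ<-cong (suc m) (λ i _ → distribʳ _ _ _)) (Σ<-distrib-+ (suc m) _ _)

    FPS-commutativeSemiring : CommutativeSemiring c ℓ
    FPS-commutativeSemiring = record
      { Carrier = FPS ; _≈_ = _≋_ ; _+_ = _⊕_ ; _*_ = _⊛_ ; 0# = zeroS ; 1# = oneS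
      ; isCommutativeSemiring = IsCommutativeSemiringˡ.isCommutativeSemiring (record
        { +-isCommutativeMonoid = record
          { isMonoid = record
            { isSemigroup = record
              { isMagma = record { isEquivalence = ≋-isEquivalence ; ∙-cong = ⊕-cong }
              ; assoc = λ f g h m → +-assoc (f m) (g m) (h m) }
            ; identity = (λ f m → +-identityˡ (f m)) , (λ f m → +-identityʳ (f m)) }
          ; comm = λ f h m → +-comm (f m) (h m) }
        ; *-isCommutativeMonoid = record
          { isMonoid = record
            { isSemigroup = record
              { isMagma = record { isEquivalence = ≋-isEquivalence ; ∙-cong = ⊛-cong }
              ; assoc = ⊛-assoc }
            ; identity = ⊛-identityˡ , (λ f m → trans (⊛-comm f oneS m) (⊛-identityˡ f m)) }
          ; comm = ⊛-comm }
        ; distribʳ = ⊛-distribʳ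
        ; zeroˡ = ⊛-zeroˡ })
      }
      where
      ≋-isEquivalence : IsEquivalence _≋_
      ≋-isEquivalence = record { refl = λ m → refl ; sym = λ f≋h m → sym (f≋h m)
                               ; trans = λ f≋h h≋k m → trans (f≋h m) (h≋k m) }

    scale-cong : ∀ {a b f h} → a ≈ b → f ≋ h → scale a f ≋ scale b h
    scale-cong a≈b f≋h m = *-cong a≈b (f≋h m)

    scale-⊛ˡ : ∀ a f h → (scale a f ⊛ h) ≋ scale a (f ⊛ h)
    scale-⊛ˡ a f h m = trans (Σ<-cong (suc m) (λ i _ → *-assoc _ _ _)) (sym (*-distribˡ-Σ< (suc m) a _))

    scale-scale : ∀ a b f → scale a (scale b f) ≋ scale (a * b) f
    scale-scale a b f m = sym (*-assoc _ _ _)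

    scale-distrib-⊕ : ∀ a f h → scale a (f ⊕ h) ≋ (scale a f ⊕ scale a h)
    scale-distrib-⊕ a f h m = distribˡ _ _ _

    scale-distrib-+ : ∀ a b f → scale (a + b) f ≋ (scale a f ⊕ scale b f)
    scale-distrib-+ a b f m = distribʳ _ _ _

    scale-zeroˡ : ∀ f → scale 0# f ≋ zeroS
    scale-zeroˡ f m = zeroˡ _

    scale-zeroʳ : ∀ a → scale a zeroS ≋ zeroS
    scale-zeroʳ a m = zeroʳ _

    scale-identity : ∀ f → scale 1# f ≋ f
    scale-identity f m = *-identityˡ _

    Dq-cong : ∀ {f h} → f ≋ h → Dq f ≋ Dq h
    Dq-cong f≋h m = *-cong refl (f≋h (suc m))

    Dq-scale : ∀ a f → Dq (scale a f) ≋ scale a (Dq f)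
    Dq-scale a f m = x∙yz≈y∙xz _ _ _

    Dq-zero : Dq zeroS ≋ zeroS
    Dq-zero m = zeroʳ _

    dil-scale : ∀ a j f → dil j (scale a f) ≋ scale a (dil j f)
    dil-scale a j f m = x∙yz≈y∙xz _ _ _

    dil-1-dil : ∀ a f → dil 1 (dil a f) ≋ dil (suc a) f
    dil-1-dil a f m = begin
      pow q (1 *ℕ m) * (pow q (a *ℕ m) * f m)  ≈⟨ *-assoc _ _ _ ⟨
      pow q (1 *ℕ m) * pow q (a *ℕ m) * f m    ≈⟨ *-cong (pow-+ q (1 *ℕ m) (a *ℕ m)) refl ⟨
      pow q (1 *ℕ m +ℕ a *ℕ m) * f m           ≈⟨ *-cong (reflexive (≡.cong (pow q) (≡.sym (ℕ.*-distribʳ-+ m 1 a)))) refl ⟩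
      pow q (suc a *ℕ m) * f m                 ∎

    Dq-dil : ∀ a f → Dq (dil a f) ≋ scale (pow q a) (dil a (Dq f))
    Dq-dil a f m = begin
      qint (suc m) * (pow q (a *ℕ suc m) * f (suc m))
        ≈⟨ *-cong refl (*-cong (trans (reflexive (≡.cong (pow q) (ℕ.*-suc a m))) (pow-+ q a (a *ℕ m))) refl) ⟩
      qint (suc m) * (pow q a * pow q (a *ℕ m) * f (suc m))
        ≈⟨ x∙yz≈y∙xz _ _ _ ⟩
      pow q a * pow q (a *ℕ m) * (qint (suc m) * f (suc m))
        ≈⟨ *-assoc _ _ _ ⟩
      pow q a * (pow q (a *ℕ m) * (qint (suc m) * f (suc m))) ∎

    -- The q-Leibniz rule, from [m+1]_q = q^(m-i) [i+1]_q + [m-i]_q.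
    Dq-⊛ : ∀ f h → Dq (f ⊛ h) ≋ ((Dq f ⊛ dil 1 h) ⊕ (f ⊛ Dq h))
    Dq-⊛ f h m = begin
      qint (suc m) * Σ< (suc (suc m)) (λ i → f i * h (suc m ∸ i))
        ≈⟨ *-cong refl (Σ<-head (suc m) _) ⟩
      qint (suc m) * (f 0 * h (suc m) + Σ< (suc m) (λ i → f (suc i) * h (m ∸ i)))
        ≈⟨ trans (distribˡ _ _ _) (+-cong refl (*-distribˡ-Σ< (suc m) _ _)) ⟩
      qint (suc m) * (f 0 * h (suc m)) + Σ< (suc m) (λ i → qint (suc m) * (f (suc i) * h (m ∸ i)))
        ≈⟨ +-cong refl (Σ<-cong (suc m) (λ i i≤m → trans (*-cong (qint-split (ℕ.≤-pred i≤m)) refl) (distribʳ _ _ _))) ⟩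
      qint (suc m) * (f 0 * h (suc m)) + Σ< (suc m) (λ i → A i + B i)
        ≈⟨ +-cong refl (Σ<-distrib-+ (suc m) A B) ⟩
      qint (suc m) * (f 0 * h (suc m)) + (Σ< (suc m) A + Σ< (suc m) B)
        ≈⟨ x+yz≈y+xz _ _ _ ⟩
      Σ< (suc m) A + (qint (suc m) * (f 0 * h (suc m)) + Σ< (suc m) B)
        ≈⟨ +-cong (Σ<-cong (suc m) (λ i _ → regroup _ _ _ _)) (+-cong (x∙yz≈y∙xz _ _ _) Σ<B) ⟩
      (Dq f ⊛ dil 1 h) m + (f 0 * Dq h m + Σ< m (λ i → f (suc i) * Dq h (m ∸ suc i)))
        ≈⟨ +-cong refl (Σ<-head m _) ⟨
      (Dq f ⊛ dil 1 h) m + (f ⊛ Dq h) m ∎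
      where
      A B : ℕ → Carrier
      A i = pow q (1 *ℕ (m ∸ i)) * qint (suc i) * (f (suc i) * h (m ∸ i))
      B i = qint (m ∸ i) * (f (suc i) * h (m ∸ i))

      qint-split : ∀ {i} → i ≤ m → qint (suc m) ≈ pow q (1 *ℕ (m ∸ i)) * qint (suc i) + qint (m ∸ i)
      qint-split {i} i≤m = begin
        qint (suc m)
          ≈⟨ reflexive (≡.cong qint (≡.sym (≡.trans (ℕ.+-suc (m ∸ i) i) (≡.cong suc (ℕ.m∸n+n≡m i≤m))))) ⟩
        qint ((m ∸ i) +ℕ suc i)                            ≈⟨ qint-+ (m ∸ i) (suc i) ⟩
        qint (m ∸ i) + pow q (m ∸ i) * qint (suc i)        ≈⟨ +-comm _ _ ⟩
        pow q (m ∸ i) * qint (suc i) + qint (m ∸ i)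
          ≈⟨ +-cong (*-cong (reflexive (≡.cong (pow q) (≡.sym (ℕ.*-identityˡ (m ∸ i))))) refl) refl ⟩
        pow q (1 *ℕ (m ∸ i)) * qint (suc i) + qint (m ∸ i) ∎

      regroup : ∀ x y z w → x * y * (z * w) ≈ y * z * (x * w)
      regroup x y z w = trans (xy∙z≈y∙xz x y (z * w)) (trans (*-cong refl (x∙yz≈y∙xz x z w)) (sym (*-assoc y z (x * w))))

      Σ<B : Σ< (suc m) B ≈ Σ< m (λ i → f (suc i) * Dq h (m ∸ suc i))
      Σ<B = begin
        Σ< m B + qint (m ∸ m) * (f (suc m) * h (m ∸ m))
          ≈⟨ +-cong refl (trans (*-cong (reflexive (≡.cong qint (ℕ.n∸n≡0 m))) refl) (zeroˡ _)) ⟩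
        Σ< m B + 0#
          ≈⟨ +-identityʳ _ ⟩
        Σ< m B
          ≈⟨ Σ<-cong m (λ i i<m → let m∸i≡ = ℕ.+-∸-assoc 1 i<m in
               trans (*-cong (reflexive (≡.cong qint m∸i≡)) (*-cong refl (reflexive (≡.cong h m∸i≡))))
                     (x∙yz≈y∙xz _ _ _)) ⟩
        Σ< m (λ i → f (suc i) * Dq h (m ∸ suc i)) ∎

    Σ<S : ℕ → (ℕ → FPS) → FPS
    Σ<S n F m = Σ< n (λ i → F i m)

    Σ<S-cong : ∀ n {F H : ℕ → FPS} → (∀ i → i < n → F i ≋ H i) → Σ<S n F ≋ Σ<S n H
    Σ<S-cong n F≋H m = Σ<-cong n (λ i i<n → F≋H i i<n m)

    Σ<S-distrib-⊕ : ∀ n (F H : ℕ → FPS) → Σ<S n (λ i → F i ⊕ H i) ≋ (Σ<S n F ⊕ Σ<S n H)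
    Σ<S-distrib-⊕ n F H m = Σ<-distrib-+ n (λ i → F i m) (λ i → H i m)

    Σ<S-head : ∀ n (F : ℕ → FPS) → Σ<S (suc n) F ≋ (F 0 ⊕ Σ<S n (λ i → F (suc i)))
    Σ<S-head n F m = Σ<-head n (λ i → F i m)

    Σ<S-swap : ∀ n k (F : ℕ → ℕ → FPS) → Σ<S n (λ i → Σ<S k (F i)) ≋ Σ<S k (λ j → Σ<S n (λ i → F i j))
    Σ<S-swap n k F m = Σ<-swap n k (λ i j → F i j m)

    Σ<S-vanishing-tail : ∀ {m} n (F : ℕ → FPS) → m ≤ n → (∀ i → m ≤ i → F i ≋ zeroS) → Σ<S n F ≋ Σ<S m F
    Σ<S-vanishing-tail n F m≤n F≋0 k = Σ<-vanishing-tail n (λ i → F i k) m≤n (λ i m≤i → F≋0 i m≤i k)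

    scale-distrib-Σ<S : ∀ n a (F : ℕ → FPS) → scale a (Σ<S n F) ≋ Σ<S n (λ i → scale a (F i))
    scale-distrib-Σ<S n a F m = *-distribˡ-Σ< n a (λ i → F i m)

    Dq-distrib-Σ<S : ∀ n (F : ℕ → FPS) → Dq (Σ<S n F) ≋ Σ<S n (λ i → Dq (F i))
    Dq-distrib-Σ<S n F m = *-distribˡ-Σ< n (qint (suc m)) (λ i → F i (suc m))

    ⊛-distribʳ-Σ<S : ∀ n (F : ℕ → FPS) h → (Σ<S n F ⊛ h) ≋ Σ<S n (λ i → F i ⊛ h)
    ⊛-distribʳ-Σ<S n F h m = begin
      Σ< (suc m) (λ j → Σ< n (λ i → F i j) * h (m ∸ j))  ≈⟨ Σ<-cong (suc m) (λ j _ → *-distribʳ-Σ< n _ _) ⟩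
      Σ< (suc m) (λ j → Σ< n (λ i → F i j * h (m ∸ j)))  ≈⟨ Σ<-swap n (suc m) (λ i j → F i j * h (m ∸ j)) ⟨
      Σ< n (λ i → Σ< (suc m) (λ j → F i j * h (m ∸ j)))  ∎

  open Coefficientwise
  open CommutativeSemiring FPS-commutativeSemiring using ()
    renaming ( setoid to ≋-setoid; refl to ≋-refl; sym to ≋-sym; trans to ≋-trans
             ; reflexive to ≋-reflexive; +-assoc to ⊕-assoc
             ; +-identityˡ to ⊕-identityˡ; +-identityʳ to ⊕-identityʳ
             ; *-identityʳ to ⊛-identityʳ; zeroʳ to ⊛-zeroʳ; distribˡ to ⊛-distribˡ)

  scale-⊛ʳ : ∀ a f h → (f ⊛ scale a h) ≋ scale a (f ⊛ h)
  scale-⊛ʳ a f h = ≋-trans (⊛-comm f _) (≋-trans (scale-⊛ˡ a h f) (scale-cong refl (⊛-comm h f)))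

  ⊛-distribˡ-Σ<S : ∀ n h (F : ℕ → FPS) → (h ⊛ Σ<S n F) ≋ Σ<S n (λ i → h ⊛ F i)
  ⊛-distribˡ-Σ<S n h F =
    ≋-trans (⊛-comm h _) (≋-trans (⊛-distribʳ-Σ<S n F h) (Σ<S-cong n (λ i _ → ⊛-comm (F i) h)))

  scale-⊛-Dq-⊛ : ∀ a f h → (scale a f ⊛ Dq (f ⊛ h)) ≋ (f ⊛ Dq (scale a f ⊛ h))
  scale-⊛-Dq-⊛ a f h = ≋-trans (scale-⊛ˡ a f (Dq (f ⊛ h))) (≋-trans (≋-sym (scale-⊛ʳ a f (Dq (f ⊛ h))))
    (⊛-congˡ f (≋-trans (≋-sym (Dq-scale a (f ⊛ h))) (Dq-cong (≋-sym (scale-⊛ˡ a f h))))))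

  if-⊛ : ∀ b f h → ((if b then f else zeroS) ⊛ h) ≋ (if b then f ⊛ h else zeroS)
  if-⊛ true  f h = ≋-refl
  if-⊛ false f h = ⊛-zeroˡ h

  Σ<S-indicator-+ : ∀ s {r b} (F : ℕ → ℕ → FPS) → r ≤ b →
    Σ<S (suc b) (λ x → if s +ℕ x ≡ᵇ r then F s x else zeroS)
      ≋ Σ<S (suc r) (λ x → if s ≡ᵇ r ∸ x then F (r ∸ x) x else zeroS)
  Σ<S-indicator-+ s {r} {b} F r≤b = ≋-trans
    -- does (m ℕ.≟ n) is, by definition, m ≡ᵇ n.
    (Σ<S-vanishing-tail (suc b) _ (s≤s r≤b) (λ x r<x → ≋-reflexive (≡.cong (if_then F s x else zeroS)
       (dec-false (s +ℕ x ℕ.≟ r) (λ s+x≡r → ℕ.<⇒≢ (ℕ.≤-trans r<x (ℕ.m≤n+m x s)) (≡.sym s+x≡r))))))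
    (Σ<S-cong (suc r) (λ x x≤r → shift x (ℕ.≤-pred x≤r)))
    where
    shift : ∀ x → x ≤ r → (if s +ℕ x ≡ᵇ r then F s x else zeroS) ≋ (if s ≡ᵇ r ∸ x then F (r ∸ x) x else zeroS)
    shift x x≤r rewrite ≡ᵇ-+-∸ {s} x≤r with s ≡ᵇ r ∸ x in s≡ᵇr∸x
    ... | false = ≋-refl
    ... | true  = ≋-reflexive (≡.cong (λ t → F t x) (ℕ.≡ᵇ⇒≡ s (r ∸ x) (≡.subst T (≡.sym s≡ᵇr∸x) _)))

  if-cong : ∀ {b b′ f f′} → b ≡ b′ → f ≋ f′ → (if b then f else zeroS) ≋ (if b′ then f′ else zeroS)
  if-cong {true}  ≡.refl f≋f′ = f≋f′
  if-cong {false} ≡.refl _    = ≋-refl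

  module AdmissibleSums (g : FPS) where
    open SetoidReasoning ≋-setoid

    sumS-++ : ∀ xs ys → sumS g (xs ++ ys) ≋ (sumS g xs ⊕ sumS g ys)
    sumS-++ []       ys = ≋-sym (⊕-identityˡ _)
    sumS-++ (x ∷ xs) ys = ≋-trans (⊕-cong ≋-refl (sumS-++ xs ys)) (≋-sym (⊕-assoc _ _ _))

    sumS-map-cong : ∀ {A : Set} {h h′ : A → FPS} xs → (∀ x → h x ≋ h′ x) → sumS g (map h xs) ≋ sumS g (map h′ xs)
    sumS-map-cong []       h≋h′ = ≋-refl
    sumS-map-cong (x ∷ xs) h≋h′ = ⊕-cong (h≋h′ x) (sumS-map-cong xs h≋h′)

    sumS-filter : ∀ {A : Set} (p : A → Bool) (h : A → FPS) xs →
      sumS g (map h (filterᵇ p xs)) ≋ sumS g (map (λ x → if p x then h x else zeroS) xs)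
    sumS-filter p h [] = ≋-refl
    sumS-filter p h (x ∷ xs) with p x
    ... | true  = ⊕-cong ≋-refl (sumS-filter p h xs)
    ... | false = ≋-trans (sumS-filter p h xs) (≋-sym (⊕-identityˡ _))

    sumS-map-concatMap : ∀ {A B : Set} (h : B → FPS) (k : A → List B) xs →
      sumS g (map h (concatMap k xs)) ≋ sumS g (map (λ x → sumS g (map h (k x))) xs)
    sumS-map-concatMap h k []       = ≋-refl
    sumS-map-concatMap h k (x ∷ xs) = begin
      sumS g (map h (k x ++ concatMap k xs))
        ≡⟨ ≡.cong (sumS g) (map-++ h (k x) (concatMap k xs)) ⟩
      sumS g (map h (k x) ++ map h (concatMap k xs))
        ≈⟨ sumS-++ (map h (k x)) _ ⟩
      sumS g (map h (k x)) ⊕ sumS g (map h (concatMap k xs))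
        ≈⟨ ⊕-cong ≋-refl (sumS-map-concatMap h k xs) ⟩
      sumS g (map h (k x)) ⊕ sumS g (map (λ y → sumS g (map h (k y))) xs) ∎

    sumS-map-applyUpTo : ∀ (F : ℕ → FPS) f n → sumS g (map F (applyUpTo f n)) ≋ Σ<S n (λ i → F (f i))
    sumS-map-applyUpTo F f zero    = ≋-refl
    sumS-map-applyUpTo F f (suc n) =
      ≋-trans (⊕-cong ≋-refl (sumS-map-applyUpTo F (λ i → f (suc i)) n)) (≋-sym (Σ<S-head n (λ i → F (f i))))

    Σtuples : ℕ → ℕ → (List ℕ → FPS) → FPS
    Σtuples zero    b h = h []
    Σtuples (suc m) b h = Σ<S (suc b) (λ x → Σtuples m b (λ xs → h (x ∷ xs)))

    sumS-tuples : ∀ m b h → sumS g (map h (tuples m b)) ≋ Σtuples m b h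
    sumS-tuples zero    b h = ⊕-identityʳ _
    sumS-tuples (suc m) b h = begin
      sumS g (map h (concatMap (λ x → map (x ∷_) (tuples m b)) (upTo (suc b))))
        ≈⟨ sumS-map-concatMap h (λ x → map (x ∷_) (tuples m b)) (upTo (suc b)) ⟩
      sumS g (map (λ x → sumS g (map h (map (x ∷_) (tuples m b)))) (upTo (suc b)))
        ≈⟨ sumS-map-cong (upTo (suc b)) (λ x → ≋-trans (≋-reflexive (≡.cong (sumS g) (≡.sym (map-∘ (tuples m b)))))
                                                         (sumS-tuples m b (λ xs → h (x ∷ xs)))) ⟩
      sumS g (map (λ x → Σtuples m b (λ xs → h (x ∷ xs))) (upTo (suc b)))
        ≈⟨ sumS-map-applyUpTo (λ x → Σtuples m b (λ xs → h (x ∷ xs))) (λ i → i) (suc b) ⟩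
      Σtuples (suc m) b h ∎

    Σtuples-cong : ∀ m b {h h′ : List ℕ → FPS} → (∀ xs → length xs ≡ m → h xs ≋ h′ xs) →
                   Σtuples m b h ≋ Σtuples m b h′
    Σtuples-cong zero    b h≋h′ = h≋h′ [] ≡.refl
    Σtuples-cong (suc m) b h≋h′ =
      Σ<S-cong (suc b) (λ x _ → Σtuples-cong m b (λ xs ∣xs∣≡m → h≋h′ (x ∷ xs) (≡.cong suc ∣xs∣≡m)))

    Σtuples-snoc : ∀ m b h → Σtuples (suc m) b h ≋ Σtuples m b (λ xs → Σ<S (suc b) (λ x → h (xs ++ [ x ])))
    Σtuples-snoc zero    b h = ≋-refl
    Σtuples-snoc (suc m) b h = Σ<S-cong (suc b) (λ y _ → Σtuples-snoc m b (λ xs → h (y ∷ xs)))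

    Σtuples-distrib-Σ<S : ∀ m b n (H : List ℕ → ℕ → FPS) →
      Σtuples m b (λ xs → Σ<S n (H xs)) ≋ Σ<S n (λ x → Σtuples m b (λ xs → H xs x))
    Σtuples-distrib-Σ<S zero    b n H = ≋-refl
    Σtuples-distrib-Σ<S (suc m) b n H = ≋-trans
      (Σ<S-cong (suc b) (λ y _ → Σtuples-distrib-Σ<S m b n (λ xs → H (y ∷ xs))))
      (Σ<S-swap (suc b) n _)

    Σtuples-⊛ʳ : ∀ m b h f → Σtuples m b (λ xs → h xs ⊛ f) ≋ (Σtuples m b h ⊛ f)
    Σtuples-⊛ʳ zero    b h f = ≋-refl
    Σtuples-⊛ʳ (suc m) b h f = ≋-trans
      (Σ<S-cong (suc b) (λ y _ → Σtuples-⊛ʳ m b (λ xs → h (y ∷ xs)) f))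
      (≋-sym (⊛-distribʳ-Σ<S (suc b) _ f))

    weight : ℕ → ℕ → ℕ → FPS
    weight j K k = scale (qint (suc j ∸ (K +ℕ k)) * invqfact k) (gij g k K)

    weight-vanishes : ∀ j K k → j < K +ℕ k → weight j K k ≋ zeroS
    weight-vanishes j K k j<K+k m =
      trans (*-cong (trans (*-cong (reflexive (≡.cong qint (ℕ.m≤n⇒m∸n≡0 j<K+k))) refl) (zeroˡ _)) refl) (zeroˡ _)

    term-vanishes : ∀ j K ks → prefixOK j K ks ≡ false → term g j K ks ≋ zeroS
    term-vanishes j K (k ∷ ks) notOK with K +ℕ k ≤ᵇ j in K+k≤ᵇj
    ... | true  = ≋-trans (⊛-congˡ (weight j K k) (term-vanishes (suc j) (K +ℕ k) ks notOK)) (⊛-zeroʳ _)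
    ... | false = ≋-trans (⊛-congʳ rest (weight-vanishes j K k j<K+k)) (⊛-zeroˡ rest)
      where
      rest = term g (suc j) (K +ℕ k) ks
      j<K+k : j < K +ℕ k
      j<K+k = ℕ.≰⇒> (λ K+k≤j → ≡.subst T K+k≤ᵇj (ℕ.≤⇒≤ᵇ K+k≤j))

    term-snoc : ∀ j K xs x → term g j K (xs ++ [ x ]) ≋ (term g j K xs ⊛ weight (j +ℕ length xs) (K +ℕ sum xs) x)
    term-snoc j K [] x = begin
      weight j K x ⊛ oneS                          ≈⟨ ⊛-identityʳ _ ⟩
      weight j K x
        ≡⟨ ≡.cong₂ (λ j′ K′ → weight j′ K′ x) (ℕ.+-identityʳ j) (ℕ.+-identityʳ K) ⟨
      weight (j +ℕ 0) (K +ℕ 0) x                   ≈⟨ ⊛-identityˡ _ ⟨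
      oneS ⊛ weight (j +ℕ 0) (K +ℕ 0) x            ∎
    term-snoc j K (y ∷ xs) x = begin
      weight j K y ⊛ term g (suc j) (K +ℕ y) (xs ++ [ x ])
        ≈⟨ ⊛-congˡ (weight j K y) (term-snoc (suc j) (K +ℕ y) xs x) ⟩
      weight j K y ⊛ (term g (suc j) (K +ℕ y) xs ⊛ weight (suc j +ℕ length xs) (K +ℕ y +ℕ sum xs) x)
        ≈⟨ ⊛-assoc (weight j K y) (term g (suc j) (K +ℕ y) xs) (weight (suc j +ℕ length xs) (K +ℕ y +ℕ sum xs) x) ⟨
      (weight j K y ⊛ term g (suc j) (K +ℕ y) xs) ⊛ weight (suc j +ℕ length xs) (K +ℕ y +ℕ sum xs) x
        ≡⟨ ≡.cong₂ (λ j′ K′ → (weight j K y ⊛ term g (suc j) (K +ℕ y) xs) ⊛ weight j′ K′ x)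
                   (≡.sym (ℕ.+-suc j (length xs))) (ℕ.+-assoc K y (sum xs)) ⟩
      (weight j K y ⊛ term g (suc j) (K +ℕ y) xs) ⊛ weight (j +ℕ suc (length xs)) (K +ℕ (y +ℕ sum xs)) x ∎

    -- termSum m r is the sum of term g 1 0 ks over all ks of length m with sum r.
    termSum : ℕ → ℕ → FPS
    termSum zero    zero    = oneS
    termSum zero    (suc r) = zeroS
    termSum (suc m) r       = Σ<S (suc r) (λ x → termSum m (r ∸ x) ⊛ weight (suc m) (r ∸ x) x)

    termIfSum : ℕ → List ℕ → FPS
    termIfSum r ks = if sum ks ≡ᵇ r then term g 1 0 ks else zeroS

    termIfSum-snoc : ∀ m r xs x → length xs ≡ m →
      termIfSum r (xs ++ [ x ]) ≋ (if sum xs +ℕ x ≡ᵇ r then term g 1 0 xs ⊛ weight (suc m) (sum xs) x else zeroS)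
    termIfSum-snoc m r xs x ∣xs∣≡m = if-cong
      (≡.cong (_≡ᵇ r) (≡.trans (sum-++ xs [ x ]) (≡.cong (sum xs +ℕ_) (ℕ.+-identityʳ x))))
      (≋-trans (term-snoc 1 0 xs x) (≋-reflexive (≡.cong (λ j → term g 1 0 xs ⊛ weight (suc j) (sum xs) x) ∣xs∣≡m)))

    termSum-tuples : ∀ m {b r} → r ≤ b → Σtuples m b (termIfSum r) ≋ termSum m r
    termSum-tuples zero {r = zero}  _ = ≋-refl
    termSum-tuples zero {r = suc r} _ = ≋-refl
    termSum-tuples (suc m) {b} {r} r≤b = begin
      Σtuples (suc m) b (termIfSum r)
        ≈⟨ Σtuples-snoc m b (termIfSum r) ⟩
      Σtuples m b (λ xs → Σ<S (suc b) (λ x → termIfSum r (xs ++ [ x ])))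
        ≈⟨ Σtuples-cong m b (λ xs ∣xs∣≡m → Σ<S-cong (suc b) (λ x _ → termIfSum-snoc m r xs x ∣xs∣≡m)) ⟩
      Σtuples m b (λ xs → Σ<S (suc b) (λ x →
        if sum xs +ℕ x ≡ᵇ r then term g 1 0 xs ⊛ weight (suc m) (sum xs) x else zeroS))
        ≈⟨ Σtuples-cong m b (λ xs _ → Σ<S-indicator-+ (sum xs) (λ s x → term g 1 0 xs ⊛ weight (suc m) s x) r≤b) ⟩
      Σtuples m b (λ xs → Σ<S (suc r) (λ x →
        if sum xs ≡ᵇ r ∸ x then term g 1 0 xs ⊛ weight (suc m) (r ∸ x) x else zeroS))
        ≈⟨ Σtuples-cong m b (λ xs _ → Σ<S-cong (suc r) (λ x _ →
             ≋-sym (if-⊛ (sum xs ≡ᵇ r ∸ x) (term g 1 0 xs) (weight (suc m) (r ∸ x) x)))) ⟩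
      Σtuples m b (λ xs → Σ<S (suc r) (λ x → termIfSum (r ∸ x) xs ⊛ weight (suc m) (r ∸ x) x))
        ≈⟨ Σtuples-distrib-Σ<S m b (suc r) _ ⟩
      Σ<S (suc r) (λ x → Σtuples m b (λ xs → termIfSum (r ∸ x) xs ⊛ weight (suc m) (r ∸ x) x))
        ≈⟨ Σ<S-cong (suc r) (λ x _ → ≋-trans (Σtuples-⊛ʳ m b (termIfSum (r ∸ x)) (weight (suc m) (r ∸ x) x))
             (⊛-congʳ (weight (suc m) (r ∸ x) x) (termSum-tuples m (ℕ.≤-trans (ℕ.m∸n≤m r x) r≤b)))) ⟩
      termSum (suc m) r ∎

    admissible-termIfSum : ∀ n k ks →
      (if admissible n k ks then term g 1 0 ks else zeroS) ≋ termIfSum (n ∸ k) ks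
    admissible-termIfSum n k ks with sum ks ≡ᵇ n ∸ k
    ... | false = ≋-refl
    ... | true with prefixOK 1 0 ks in notOK
    ...   | true  = ≋-refl
    ...   | false = ≋-sym (term-vanishes 1 0 ks notOK)

    L≋termSum : ∀ n k → L g n k ≋ (scale (invqfact k) g ⊛ termSum (n ∸ 1) (n ∸ k))
    L≋termSum n k = ⊛-cong (scale-cong refl (λ m → *-identityˡ (g m))) (begin
      sumS g (map (term g 1 0) (filterᵇ (admissible n k) (tuples (n ∸ 1) n)))
        ≈⟨ sumS-filter (admissible n k) (term g 1 0) (tuples (n ∸ 1) n) ⟩
      sumS g (map (λ ks → if admissible n k ks then term g 1 0 ks else zeroS) (tuples (n ∸ 1) n))
        ≈⟨ sumS-map-cong (tuples (n ∸ 1) n) (admissible-termIfSum n k) ⟩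
      sumS g (map (termIfSum (n ∸ k)) (tuples (n ∸ 1) n))
        ≈⟨ sumS-tuples (n ∸ 1) n (termIfSum (n ∸ k)) ⟩
      Σtuples (n ∸ 1) n (termIfSum (n ∸ k))
        ≈⟨ termSum-tuples (n ∸ 1) (ℕ.m∸n≤m n k) ⟩
      termSum (n ∸ 1) (n ∸ k) ∎)

  module Recurrence (g : FPS) (qint-inverse : ∀ m → qint (suc m) * (qint (suc m) ⁻¹) ≈ 1#) where
    open AdmissibleSums g
    open SetoidReasoning ≋-setoid

    qint-*-invqfact : ∀ m → qint (suc m) * invqfact (suc m) ≈ invqfact m
    qint-*-invqfact m = trans (x∙yz≈y∙xz _ _ _) (trans (*-cong refl (qint-inverse m)) (*-identityʳ _))

    invqfact-1 : invqfact 1 ≈ 1#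
    invqfact-1 = trans (sym (trans (*-cong (+-identityˡ 1#) refl) (*-identityˡ _))) (qint-*-invqfact 0)

    G : ℕ → ℕ → FPS
    G K x = scale (invqfact x) (gij g x (K ∸ x))

    G-0-0 : G 0 0 ≋ g
    G-0-0 m = trans (*-identityˡ _) (*-identityˡ _)

    G-dil : ∀ {K x} → x ≤ K → dil 1 (G K x) ≋ G (suc K) x
    G-dil {K} {x} x≤K = ≋-trans (dil-scale (invqfact x) 1 (gij g x (K ∸ x)))
      (scale-cong refl (≋-trans (dil-1-dil (K ∸ x) (Dq^ x g))
        (≋-reflexive (≡.cong (λ t → dil t (Dq^ x g)) (≡.sym (ℕ.+-∸-assoc 1 x≤K))))))

    Dq-G : ∀ K x → Dq (G K x) ≋ scale (pow q (K ∸ x) * qint (suc x)) (G (suc K) (suc x))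
    Dq-G K x = begin
      Dq (scale (invqfact x) (dil a X))                        ≈⟨ Dq-scale (invqfact x) (dil a X) ⟩
      scale (invqfact x) (Dq (dil a X))                        ≈⟨ scale-cong refl (Dq-dil a X) ⟩
      scale (invqfact x) (scale (pow q a) (dil a (Dq X)))      ≈⟨ scale-scale (invqfact x) (pow q a) (dil a (Dq X)) ⟩
      scale (invqfact x * pow q a) (dil a (Dq X))              ≈⟨ scale-cong coefficient ≋-refl ⟩
      scale (pow q a * qint (suc x) * invqfact (suc x)) (dil a (Dq X))
        ≈⟨ scale-scale (pow q a * qint (suc x)) (invqfact (suc x)) (dil a (Dq X)) ⟨
      scale (pow q a * qint (suc x)) (G (suc K) (suc x))       ∎
      where
      a = K ∸ x
      X = Dq^ x g
      coefficient : invqfact x * pow q a ≈ pow q a * qint (suc x) * invqfact (suc x)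
      coefficient = trans (*-comm _ _) (trans (*-cong refl (sym (qint-*-invqfact x))) (sym (*-assoc _ _ _)))

    weight-G : ∀ m {K x} → x ≤ K → weight (suc m) (K ∸ x) x ≋ scale (qint (suc (suc m) ∸ K)) (G K x)
    weight-G m {K} {x} x≤K k = trans
      (*-cong (*-cong (reflexive (≡.cong (λ t → qint (suc (suc m) ∸ t)) (ℕ.m∸n+n≡m x≤K))) refl) refl)
      (*-assoc _ _ _)

    termSum-suc : ∀ m K → termSum (suc m) K ≋
      scale (qint (suc (suc m) ∸ K)) (Σ<S (suc K) (λ x → termSum m (K ∸ x) ⊛ G K x))
    termSum-suc m K = ≋-trans
      (Σ<S-cong (suc K) (λ x x≤K → ≋-trans (⊛-congˡ (termSum m (K ∸ x)) (weight-G m (ℕ.≤-pred x≤K)))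
                                           (scale-⊛ʳ _ (termSum m (K ∸ x)) (G K x))))
      (≋-sym (scale-distrib-Σ<S (suc K) _ (λ x → termSum m (K ∸ x) ⊛ G K x)))

    termSum-vanishes : ∀ m {r} → m < r → termSum m r ≋ zeroS
    termSum-vanishes zero    {suc r} _   = ≋-refl
    termSum-vanishes (suc m) {r}     m<r = ≋-trans (termSum-suc m r)
      (≋-trans (scale-cong (reflexive (≡.cong qint (ℕ.m≤n⇒m∸n≡0 m<r))) ≋-refl) (scale-zeroˡ _))

    gT : ℕ → ℕ → FPS
    gT m K = g ⊛ termSum m K

    -- gT m (K ∸ 1), except that it is zero at K = 0.
    gT⁻ : ℕ → ℕ → FPS
    gT⁻ m zero    = zeroS
    gT⁻ m (suc K) = gT m K

    gT⊛G : ℕ → ℕ → ℕ → FPS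
    gT⊛G m K x = gT m (K ∸ x) ⊛ G K x

    gTG : ℕ → ℕ → FPS
    gTG m K = Σ<S (suc K) (gT⊛G m K)

    gT-suc : ∀ m K → gT (suc m) K ≋ scale (qint (suc (suc m) ∸ K)) (gTG m K)
    gT-suc m K = begin
      g ⊛ termSum (suc m) K
        ≈⟨ ⊛-congˡ g (termSum-suc m K) ⟩
      g ⊛ scale w (Σ<S (suc K) F)
        ≈⟨ scale-⊛ʳ w g (Σ<S (suc K) F) ⟩
      scale w (g ⊛ Σ<S (suc K) F)
        ≈⟨ scale-cong refl (⊛-distribˡ-Σ<S (suc K) g F) ⟩
      scale w (Σ<S (suc K) (λ x → g ⊛ (termSum m (K ∸ x) ⊛ G K x)))
        ≈⟨ scale-cong refl (Σ<S-cong (suc K) (λ x _ → ⊛-assoc g (termSum m (K ∸ x)) (G K x))) ⟨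
      scale w (gTG m K) ∎
      where
      w = qint (suc (suc m) ∸ K)
      F : ℕ → FPS
      F x = termSum m (K ∸ x) ⊛ G K x

    RecurrenceAt : ℕ → ℕ → Set ℓ
    RecurrenceAt n K = termSum (suc n) K ≋ (Dq (gT⁻ n K) ⊕ scale (pow q K * qint (suc (suc n) ∸ K)) (gT n K))

    recurrence-zero : ∀ n → RecurrenceAt n 0
    recurrence-zero n = begin
      termSum (suc n) 0                          ≈⟨ termSum-suc n 0 ⟩
      scale w (zeroS ⊕ (termSum n 0 ⊛ G 0 0))    ≈⟨ scale-cong refl (⊕-identityˡ _) ⟩
      scale w (termSum n 0 ⊛ G 0 0)              ≈⟨ scale-cong refl (⊛-congˡ (termSum n 0) G-0-0) ⟩
      scale w (termSum n 0 ⊛ g)                  ≈⟨ scale-cong (*-identityˡ w) (⊛-comm g (termSum n 0)) ⟨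
      scale (1# * w) (gT n 0)                    ≈⟨ ⊕-identityˡ _ ⟨
      zeroS ⊕ scale (1# * w) (gT n 0)            ≈⟨ ⊕-cong Dq-zero ≋-refl ⟨
      Dq zeroS ⊕ scale (1# * w) (gT n 0)         ∎
      where w = qint (suc (suc n))

    recurrence-out-of-range : ∀ n K → suc n < K → RecurrenceAt n K
    recurrence-out-of-range n (suc K) n+1<K+1 = begin
      termSum (suc n) (suc K)   ≈⟨ termSum-vanishes (suc n) n+1<K+1 ⟩
      zeroS                     ≈⟨ ⊕-identityˡ zeroS ⟨
      zeroS ⊕ zeroS             ≈⟨ ⊕-cong Dq-part scale-part ⟨
      Dq (gT n K) ⊕ scale (pow q (suc K) * qint (suc n ∸ K)) (gT n (suc K)) ∎
      where
      Dq-part : Dq (gT n K) ≋ zeroS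
      Dq-part = ≋-trans (Dq-cong (≋-trans (⊛-congˡ g (termSum-vanishes n (ℕ.≤-pred n+1<K+1))) (⊛-zeroʳ g))) Dq-zero
      scale-part : scale (pow q (suc K) * qint (suc n ∸ K)) (gT n (suc K)) ≋ zeroS
      scale-part = ≋-trans
        (scale-cong (trans (*-cong refl (reflexive (≡.cong qint (ℕ.m≤n⇒m∸n≡0 (ℕ.≤-pred n+1<K+1))))) (zeroʳ _)) ≋-refl)
        (scale-zeroˡ _)

    recurrence-base : RecurrenceAt 0 1
    recurrence-base = begin
      termSum 1 1
        ≈⟨ termSum-suc 0 1 ⟩
      scale (qint 1) ((zeroS ⊕ (zeroS ⊛ G 1 0)) ⊕ (oneS ⊛ G 1 1))
        ≈⟨ scale-cong refl (⊕-cong (≋-trans (⊕-identityˡ _) (⊛-zeroˡ (G 1 0))) (⊛-identityˡ (G 1 1))) ⟩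
      scale (qint 1) (zeroS ⊕ G 1 1)
        ≈⟨ scale-cong refl (⊕-identityˡ _) ⟩
      scale (qint 1) (scale (invqfact 1) (gij g 1 0))
        ≈⟨ scale-scale (qint 1) (invqfact 1) (gij g 1 0) ⟩
      scale (qint 1 * invqfact 1) (gij g 1 0)
        ≈⟨ scale-cong (qint-*-invqfact 0) (λ m → *-identityˡ _) ⟩
      scale 1# (Dq g)
        ≈⟨ scale-identity (Dq g) ⟩
      Dq g
        ≈⟨ ⊕-identityʳ (Dq g) ⟨
      Dq g ⊕ zeroS
        ≈⟨ ⊕-cong (Dq-cong (⊛-identityʳ g)) (≋-trans (scale-cong refl (⊛-zeroʳ g)) (scale-zeroʳ _)) ⟨
      Dq (g ⊛ oneS) ⊕ scale (pow q 1 * qint 1) (g ⊛ zeroS) ∎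

    Dq-gT-suc : ∀ n K′ → Dq (gT (suc n) K′) ≋ scale (qint (suc (suc n) ∸ K′))
      (Σ<S (suc K′) (λ x → Dq (gT n (K′ ∸ x)) ⊛ G (suc K′) x)
        ⊕ Σ<S (suc K′) (λ x → scale (pow q (K′ ∸ x) * qint (suc x)) (gT⊛G n (suc K′) (suc x))))
    Dq-gT-suc n K′ = begin
      Dq (gT (suc n) K′)
        ≈⟨ Dq-cong (gT-suc n K′) ⟩
      Dq (scale w (gTG n K′))
        ≈⟨ Dq-scale w (gTG n K′) ⟩
      scale w (Dq (gTG n K′))
        ≈⟨ scale-cong refl (Dq-distrib-Σ<S (suc K′) (gT⊛G n K′)) ⟩
      scale w (Σ<S (suc K′) (λ x → Dq (gT⊛G n K′ x)))
        ≈⟨ scale-cong refl (Σ<S-cong (suc K′) (λ x x≤K′ → leibniz x (ℕ.≤-pred x≤K′))) ⟩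
      scale w (Σ<S (suc K′) (λ x → (Dq (gT n (K′ ∸ x)) ⊛ G (suc K′) x) ⊕ scale (d x) (gT⊛G n (suc K′) (suc x))))
        ≈⟨ scale-cong refl (Σ<S-distrib-⊕ (suc K′) _ _) ⟩
      scale w (Σ<S (suc K′) (λ x → Dq (gT n (K′ ∸ x)) ⊛ G (suc K′) x)
                ⊕ Σ<S (suc K′) (λ x → scale (d x) (gT⊛G n (suc K′) (suc x)))) ∎
      where
      w = qint (suc (suc n) ∸ K′)
      d : ℕ → Carrier
      d x = pow q (K′ ∸ x) * qint (suc x)
      leibniz : ∀ x → x ≤ K′ →
        Dq (gT⊛G n K′ x) ≋ ((Dq (gT n (K′ ∸ x)) ⊛ G (suc K′) x) ⊕ scale (d x) (gT⊛G n (suc K′) (suc x)))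
      leibniz x x≤K′ = ≋-trans (Dq-⊛ (gT n (K′ ∸ x)) (G K′ x))
        (⊕-cong (⊛-congˡ (Dq (gT n (K′ ∸ x))) (G-dil x≤K′))
                (≋-trans (⊛-congˡ (gT n (K′ ∸ x)) (Dq-G K′ x)) (scale-⊛ʳ (d x) (gT n (K′ ∸ x)) (G (suc K′) (suc x)))))

    Σ<S-Dq-gT⁻ : ∀ n K′ → Σ<S (suc (suc K′)) (λ x → Dq (gT⁻ n (suc K′ ∸ x)) ⊛ G (suc K′) x)
                         ≋ Σ<S (suc K′) (λ x → Dq (gT n (K′ ∸ x)) ⊛ G (suc K′) x)
    Σ<S-Dq-gT⁻ n K′ = ≋-trans
      (⊕-cong (Σ<S-cong (suc K′) (λ x x≤K′ →
                 ≋-reflexive (≡.cong (λ t → Dq (gT⁻ n t) ⊛ G (suc K′) x) (ℕ.+-∸-assoc 1 (ℕ.≤-pred x≤K′)))))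
              (≋-trans (≋-reflexive (≡.cong (λ t → Dq (gT⁻ n t) ⊛ G (suc K′) (suc K′)) (ℕ.n∸n≡0 K′)))
                       (≋-trans (⊛-congʳ (G (suc K′) (suc K′)) Dq-zero) (⊛-zeroˡ (G (suc K′) (suc K′))))))
      (⊕-identityʳ _)

    Σ<S-scale-gT⊛G : ∀ n K′ → suc K′ ≤ suc (suc n) →
      Σ<S (suc (suc K′)) (λ x → scale (pow q (suc K′ ∸ x) * qint (suc (suc n) ∸ (suc K′ ∸ x))) (gT⊛G n (suc K′) x))
        ≋ (Σ<S (suc K′) (λ x → scale (pow q (K′ ∸ x) * qint (suc x)) (gT⊛G n (suc K′) (suc x)))
           ⊕ scale (pow q (suc K′) * qint (suc (suc n) ∸ suc K′)) (gTG n (suc K′)))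
    Σ<S-scale-gT⊛G n K′ K≤n+2 = begin
      Σ<S (suc K) (λ x → scale (e x) (b x))
        ≈⟨ Σ<S-head K (λ x → scale (e x) (b x)) ⟩
      scale qw (b 0) ⊕ Σ<S K (λ x → scale (e (suc x)) (b (suc x)))
        ≈⟨ ⊕-cong ≋-refl (Σ<S-cong K (λ x x≤K′ → ≋-trans (scale-cong (pow-*-qint-∸ (ℕ.≤-pred x≤K′) K≤n+2) ≋-refl)
                                                        (scale-distrib-+ (d x) qw (b (suc x))))) ⟩
      scale qw (b 0) ⊕ Σ<S K (λ x → scale (d x) (b (suc x)) ⊕ scale qw (b (suc x)))
        ≈⟨ ⊕-cong ≋-refl (Σ<S-distrib-⊕ K _ _) ⟩
      scale qw (b 0) ⊕ (Y ⊕ Σ<S K (λ x → scale qw (b (suc x))))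
        ≈⟨ (λ m → x+yz≈y+xz _ _ _) ⟩
      Y ⊕ (scale qw (b 0) ⊕ Σ<S K (λ x → scale qw (b (suc x))))
        ≈⟨ ⊕-cong ≋-refl (Σ<S-head K (λ x → scale qw (b x))) ⟨
      Y ⊕ Σ<S (suc K) (λ x → scale qw (b x))
        ≈⟨ ⊕-cong ≋-refl (scale-distrib-Σ<S (suc K) qw b) ⟨
      Y ⊕ scale qw (gTG n K) ∎
      where
      K = suc K′
      b = gT⊛G n K
      e d : ℕ → Carrier
      e x = pow q (K ∸ x) * qint (suc (suc n) ∸ (K ∸ x))
      d x = pow q (K′ ∸ x) * qint (suc x)
      qw = pow q K * qint (suc (suc n) ∸ K)
      Y = Σ<S K (λ x → scale (d x) (b (suc x)))

    recurrence-step : ∀ n K′ → suc K′ ≤ suc (suc n) → (∀ K → RecurrenceAt n K) → RecurrenceAt (suc n) (suc K′)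
    recurrence-step n K′ K≤n+2 IH = begin
      termSum (suc (suc n)) K
        ≈⟨ termSum-suc (suc n) K ⟩
      scale w (Σ<S (suc K) (λ x → termSum (suc n) (K ∸ x) ⊛ G K x))
        ≈⟨ scale-cong refl (Σ<S-cong (suc K) (λ x _ → expand x)) ⟩
      scale w (Σ<S (suc K) (λ x → (Dq (gT⁻ n (K ∸ x)) ⊛ G K x) ⊕ scale (e x) (gT⊛G n K x)))
        ≈⟨ scale-cong refl (Σ<S-distrib-⊕ (suc K) _ _) ⟩
      scale w (Σ<S (suc K) (λ x → Dq (gT⁻ n (K ∸ x)) ⊛ G K x) ⊕ Σ<S (suc K) (λ x → scale (e x) (gT⊛G n K x)))
        ≈⟨ scale-cong refl (⊕-cong (Σ<S-Dq-gT⁻ n K′) (Σ<S-scale-gT⊛G n K′ K≤n+2)) ⟩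
      scale w (X ⊕ (Y ⊕ scale qw S))
        ≈⟨ scale-cong refl (⊕-assoc X Y (scale qw S)) ⟨
      scale w ((X ⊕ Y) ⊕ scale qw S)
        ≈⟨ scale-distrib-⊕ w (X ⊕ Y) (scale qw S) ⟩
      scale w (X ⊕ Y) ⊕ scale w (scale qw S)
        ≈⟨ ⊕-cong (Dq-gT-suc n K′) reassociate ⟨
      Dq (gT (suc n) K′) ⊕ scale (pow q K * w) (scale (qint (suc (suc n) ∸ K)) S)
        ≈⟨ ⊕-cong ≋-refl (scale-cong refl (gT-suc n K)) ⟨
      Dq (gT (suc n) K′) ⊕ scale (pow q K * w) (gT (suc n) K) ∎
      where
      K = suc K′
      w = qint (suc (suc n) ∸ K′)
      e : ℕ → Carrier
      e x = pow q (K ∸ x) * qint (suc (suc n) ∸ (K ∸ x))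
      qw = pow q K * qint (suc (suc n) ∸ K)
      S = gTG n K
      X = Σ<S K (λ x → Dq (gT n (K′ ∸ x)) ⊛ G K x)
      Y = Σ<S K (λ x → scale (pow q (K′ ∸ x) * qint (suc x)) (gT⊛G n K (suc x)))

      expand : ∀ x → (termSum (suc n) (K ∸ x) ⊛ G K x) ≋ ((Dq (gT⁻ n (K ∸ x)) ⊛ G K x) ⊕ scale (e x) (gT⊛G n K x))
      expand x = ≋-trans (⊛-congʳ (G K x) (IH (K ∸ x)))
        (≋-trans (⊛-distribʳ (G K x) (Dq (gT⁻ n (K ∸ x))) (scale (e x) (gT n (K ∸ x))))
                 (⊕-cong ≋-refl (scale-⊛ˡ (e x) (gT n (K ∸ x)) (G K x))))

      reassociate : scale (pow q K * w) (scale (qint (suc (suc n) ∸ K)) S) ≋ scale w (scale qw S)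
      reassociate m = trans (sym (*-assoc _ _ _)) (trans (*-cong (trans (*-cong (*-comm _ _) refl) (*-assoc _ _ _)) refl) (*-assoc _ _ _))

    termSum-recurrence : ∀ n K → RecurrenceAt n K
    termSum-recurrence n zero = recurrence-zero n
    termSum-recurrence n (suc K) with suc K ≤? suc n
    ... | no  K≰n = recurrence-out-of-range n (suc K) (ℕ.≰⇒> K≰n)
    termSum-recurrence zero    (suc zero)    | yes _         = recurrence-base
    termSum-recurrence zero    (suc (suc K)) | yes (s≤s ())
    termSum-recurrence (suc n) (suc K)       | yes K+1≤n+2   = recurrence-step n K K+1≤n+2 (termSum-recurrence n)

    L-recurrence : ∀ n k K → K +ℕ k ≡ suc (suc n) →
      L g (suc (suc n)) k ≋ ((scale (invqfact k) g ⊛ Dq (gT⁻ n K))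
                             ⊕ (scale (invqfact k) g ⊛ scale (pow q K * qint k) (gT n K)))
    L-recurrence n k K K+k≡n+2 = begin
      L g (suc (suc n)) k
        ≈⟨ L≋termSum (suc (suc n)) k ⟩
      c·g ⊛ termSum (suc n) (suc (suc n) ∸ k)
        ≡⟨ ≡.cong (λ t → c·g ⊛ termSum (suc n) t) n+2∸k≡K ⟩
      c·g ⊛ termSum (suc n) K
        ≈⟨ ⊛-congˡ c·g (termSum-recurrence n K) ⟩
      c·g ⊛ (Dq (gT⁻ n K) ⊕ scale (pow q K * qint (suc (suc n) ∸ K)) (gT n K))
        ≡⟨ ≡.cong (λ t → c·g ⊛ (Dq (gT⁻ n K) ⊕ scale (pow q K * qint t) (gT n K))) n+2∸K≡k ⟩
      c·g ⊛ (Dq (gT⁻ n K) ⊕ scale (pow q K * qint k) (gT n K))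
        ≈⟨ ⊛-distribˡ c·g (Dq (gT⁻ n K)) (scale (pow q K * qint k) (gT n K)) ⟩
      (c·g ⊛ Dq (gT⁻ n K)) ⊕ (c·g ⊛ scale (pow q K * qint k) (gT n K)) ∎
      where
      c·g = scale (invqfact k) g
      n+2∸k≡K : suc (suc n) ∸ k ≡ K
      n+2∸k≡K = ≡.trans (≡.cong (_∸ k) (≡.sym K+k≡n+2)) (ℕ.m+n∸n≡m K k)
      n+2∸K≡k : suc (suc n) ∸ K ≡ k
      n+2∸K≡k = ≡.trans (≡.cong (_∸ K) (≡.sym K+k≡n+2)) (ℕ.m+n∸m≡n K k)

    scale-invqfact-⊛-scale : ∀ p k h →
      (scale (invqfact (suc k)) g ⊛ scale (p * qint (suc k)) (g ⊛ h)) ≋ (g ⊛ scale p (scale (invqfact k) g ⊛ h))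
    scale-invqfact-⊛-scale p k h = begin
      scale c₊ g ⊛ scale (p * qint (suc k)) (g ⊛ h)     ≈⟨ scale-⊛ˡ c₊ g (scale (p * qint (suc k)) (g ⊛ h)) ⟩
      scale c₊ (g ⊛ scale (p * qint (suc k)) (g ⊛ h))   ≈⟨ scale-cong refl (scale-⊛ʳ _ g (g ⊛ h)) ⟩
      scale c₊ (scale (p * qint (suc k)) (g ⊛ (g ⊛ h))) ≈⟨ scale-scale c₊ _ _ ⟩
      scale (c₊ * (p * qint (suc k))) (g ⊛ (g ⊛ h))     ≈⟨ scale-cong coefficient ≋-refl ⟩
      scale (p * a) (g ⊛ (g ⊛ h))                       ≈⟨ scale-scale p a _ ⟨
      scale p (scale a (g ⊛ (g ⊛ h)))                   ≈⟨ scale-cong refl (scale-⊛ʳ a g (g ⊛ h)) ⟨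
      scale p (g ⊛ scale a (g ⊛ h))                     ≈⟨ scale-⊛ʳ p g (scale a (g ⊛ h)) ⟨
      g ⊛ scale p (scale a (g ⊛ h))                     ≈⟨ ⊛-congˡ g (scale-cong refl (scale-⊛ˡ a g h)) ⟨
      g ⊛ scale p (scale a g ⊛ h)                       ∎
      where
      a = invqfact k
      c₊ = invqfact (suc k)
      coefficient : c₊ * (p * qint (suc k)) ≈ p * a
      coefficient = trans (x∙yz≈y∙xz _ _ _) (*-cong refl (trans (*-comm _ _) (qint-*-invqfact k)))

    L-1-1 : L g 1 1 ≋ g
    L-1-1 = begin
      L g 1 1                      ≈⟨ L≋termSum 1 1 ⟩
      scale (invqfact 1) g ⊛ oneS  ≈⟨ ⊛-identityʳ _ ⟩
      scale (invqfact 1) g         ≈⟨ scale-cong invqfact-1 ≋-refl ⟩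
      scale 1# g                   ≈⟨ scale-identity g ⟩
      g                            ∎

    L-first-column : ∀ n → 1 ≤ n → L g (suc n) 1 ≋ (g ⊛ Dq (L g n 1))
    L-first-column (suc n) _ = begin
      L g (suc (suc n)) 1
        ≈⟨ L-recurrence n 1 (suc n) (ℕ.+-comm (suc n) 1) ⟩
      (c·g ⊛ Dq (gT n n)) ⊕ (c·g ⊛ scale (pow q (suc n) * qint 1) (gT n (suc n)))
        ≈⟨ ⊕-cong (scale-⊛-Dq-⊛ (invqfact 1) g (termSum n n)) vanishing ⟩
      (g ⊛ Dq (c·g ⊛ termSum n n)) ⊕ zeroS
        ≈⟨ ⊕-identityʳ _ ⟩
      g ⊛ Dq (c·g ⊛ termSum n n)
        ≈⟨ ⊛-congˡ g (Dq-cong (L≋termSum (suc n) 1)) ⟨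
      g ⊛ Dq (L g (suc n) 1) ∎
      where
      c·g = scale (invqfact 1) g
      vanishing : (c·g ⊛ scale (pow q (suc n) * qint 1) (gT n (suc n))) ≋ zeroS
      vanishing = ≋-trans (⊛-congˡ c·g (≋-trans (scale-cong refl (≋-trans (⊛-congˡ g (termSum-vanishes n ℕ.≤-refl))
                                                                            (⊛-zeroʳ g)))
                                                 (scale-zeroʳ _)))
                          (⊛-zeroʳ c·g)

    L-diagonal : ∀ n → 1 ≤ n → L g (suc n) (suc n) ≋ (g ⊛ L g n n)
    L-diagonal (suc n) _ = begin
      L g (suc (suc n)) (suc (suc n))
        ≈⟨ L-recurrence n (suc (suc n)) 0 ≡.refl ⟩
      (c·g ⊛ Dq zeroS) ⊕ (c·g ⊛ scale (1# * qint (suc (suc n))) (gT n 0))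
        ≈⟨ ⊕-cong (≋-trans (⊛-congˡ c·g Dq-zero) (⊛-zeroʳ c·g)) (scale-invqfact-⊛-scale 1# (suc n) (termSum n 0)) ⟩
      zeroS ⊕ (g ⊛ scale 1# (scale (invqfact (suc n)) g ⊛ termSum n 0))
        ≈⟨ ⊕-identityˡ _ ⟩
      g ⊛ scale 1# (scale (invqfact (suc n)) g ⊛ termSum n 0)
        ≈⟨ ⊛-congˡ g (scale-identity (scale (invqfact (suc n)) g ⊛ termSum n 0)) ⟩
      g ⊛ (scale (invqfact (suc n)) g ⊛ termSum n 0)
        ≈⟨ ⊛-congˡ g (≋-trans (L≋termSum (suc n) (suc n))
                              (≋-reflexive (≡.cong (λ t → scale (invqfact (suc n)) g ⊛ termSum n t) (ℕ.n∸n≡0 n)))) ⟨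
      g ⊛ L g (suc n) (suc n) ∎
      where c·g = scale (invqfact (suc (suc n))) g

    L-interior : ∀ n k → 1 < k → k ≤ n →
      L g (suc n) k ≋ ((g ⊛ Dq (L g n k)) ⊕ (g ⊛ scale (pow q (suc (n ∸ k))) (L g n (k ∸ 1))))
    L-interior (suc n) (suc k) (s≤s 1≤k) (s≤s k≤n) = begin
      L g (suc (suc n)) (suc k)
        ≈⟨ L-recurrence n (suc k) (suc K) K+k≡ ⟩
      (c·g ⊛ Dq (gT n K)) ⊕ (c·g ⊛ scale (pow q (suc K) * qint (suc k)) (gT n (suc K)))
        ≈⟨ ⊕-cong (scale-⊛-Dq-⊛ (invqfact (suc k)) g (termSum n K))
                  (scale-invqfact-⊛-scale (pow q (suc K)) k (termSum n (suc K))) ⟩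
      (g ⊛ Dq (c·g ⊛ termSum n K)) ⊕ (g ⊛ scale (pow q (suc K)) (scale (invqfact k) g ⊛ termSum n (suc K)))
        ≈⟨ ⊕-cong (⊛-congˡ g (Dq-cong (L≋termSum (suc n) (suc k))))
                  (⊛-congˡ g (scale-cong refl (≋-trans (L≋termSum (suc n) k)
                    (≋-reflexive (≡.cong (λ t → scale (invqfact k) g ⊛ termSum n t) (ℕ.+-∸-assoc 1 k≤n)))))) ⟨
      (g ⊛ Dq (L g (suc n) (suc k))) ⊕ (g ⊛ scale (pow q (suc K)) (L g (suc n) k)) ∎
      where
      K = n ∸ k
      c·g = scale (invqfact (suc k)) g
      K+k≡ : suc K +ℕ suc k ≡ suc (suc n)
      K+k≡ = ≡.cong suc (≡.trans (ℕ.+-suc K k) (≡.cong suc (ℕ.m∸n+n≡m k≤n)))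

mainTheorem12 :
    ∀ {c ℓ : Level} (R : CommutativeRing c ℓ) →
    let open CommutativeRing R in
    (_⁻¹ : Carrier → Carrier) →
    ¬ (1# ≈ 0#) →
    (∀ x → ¬ (x ≈ 0#) → (x * (x ⁻¹)) ≈ 1#) →
    (q : Carrier) →
    let open Series R _⁻¹ q in
    (∀ m → ¬ (qint (suc m) ≈ 0#)) →
    (g : FPS) →
      (L g 1 1 ≋ g)
      × (∀ n → 1 ≤ n → L g (suc n) 1 ≋ (g ⊛ Dq (L g n 1)))
      × (∀ n → 1 ≤ n → L g (suc n) (suc n) ≋ (g ⊛ L g n n))
      × (∀ n k → 1 < k → k ≤ n →
           L g (suc n) k
             ≋ ((g ⊛ Dq (L g n k))
                 ⊕ (g ⊛ scale (pow q (suc (n ∸ k))) (L g n (k ∸ 1)))))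
mainTheorem12 R _⁻¹ _ inverse q qint≉0 g = L-1-1 , L-first-column , L-diagonal , L-interior
  where
  open SeriesProperties.Recurrence R _⁻¹ q g (λ m → inverse _ (qint≉0 m))
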